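{- Let $G$ be a finite connected multigraph with root $q$, and let $\Sigma$ be any tree growing sequence for $G$. For any function $f:V(G)\setminus\{q\}\to\mathbb{Z}$, the TGS algorithm with $\Sigma$ applied to $f$ terminates with a tree $T_f=(U,X)$ that is a spanning tree of $G$ (i.e. $U=V(G)$) if and only if $f\in\mathcal{P}_{G,q}$.
   Context: $G=(V,E)$ is a finite connected multigraph (loops and multiple edges allowed), $V=\{q,v_1,\dots,v_n\}$ with root $q$; parallel edges are given a fixed order. For $A\subseteq V\setminus\{q\}$ and $v\in A$, $outdeg_A(v)$ is the number of edges, with multiplicity, joining $v$ to vertices not in $A$. A $G$-parking function is a function $f:V\setminus\{q\}\to\mathbb{Z}_{\ge 0}$ such that every nonempty $A\subseteq V\setminus\{q\}$ contains a vertex $v$ with $0\le f(v)<outdeg_A(v)$; $\mathcal{P}_{G,q}$ is the set of these. A rooted tree in an edge set $S\subseteq E$ is a tree subgraph containing $q$ all of whose edges lie in $S$ (the one-vertex tree $\{q\}$ included). A tree growing sequence (TGS) $\Sigma=\{(S,\sigma_S)\}$ assigns to every $S\subseteq E$ and every rooted tree $T$ in $S$ an edge $\sigma_S(T)\in S\setminus E(T)$ having an endpoint in $V(T)$ (so $T\cup\sigma_S(T)$ is connected), whenever such an edge exists; $\sigma_S(T)$ is undefined when no edge of $S\setminus E(T)$ meets $V(T)$. The TGS algorithm applied to $f:V\setminus\{q\}\to\mathbb{Z}$ maintains an edge set $S$ (initially $E$), a tree $T=(U,X)$ (initially $U=\{q\}$, $X=\emptyset$), integers $\alpha,\beta$ (initially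 $0$) and a working copy of $f$. While $e=\sigma_S(T)$ is defined: let $e_t\in U$ be an endpoint of $e$ in $U$ and $e_h$ the other endpoint. If $e_h\in U$ ($T\cup e$ contains a cycle), remove $e$ from $S$ and increase $\beta$ by $1$. Otherwise, if $f(e_h)<0$ the algorithm terminates; if $f(e_h)=0$, add $e$ to $X$ and $e_h$ to $U$, and if moreover $e$ is a bridge of the graph $(V,S)$ increase $\alpha$ by $1$; if $f(e_h)\ge 1$, decrease $f(e_h)$ by $1$ and remove $e$ from $S$. The output is the tree $T_f=(U,X)$ and the monomial $x^\alpha y^\beta$. -}

module Defs where

open import Data.Nat using (ℕ; zero; suc; _+_)
open import Data.Integer as ℤ using (ℤ; _<_; _≤_; _-_) renaming (+_ to ℤ+)
open import Data.Fin as Fin using (Fin; zero; suc)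
open import Data.Fin.Subset using (Subset; _∈_; _∉_; ⁅_⁆; _∪_; _─_; ⊤; ⊥; Nonempty)
open import Data.Fin.Properties using () renaming (_≟_ to _≟ᶠ_)
open import Data.Vec using (lookup)
open import Data.Bool using (Bool; true; false; if_then_else_; _∧_; _∨_; not)
open import Data.List using (List; []; _∷_; map; allFin)
open import Data.Nat.ListAction using (sum)
open import Data.List.Relation.Unary.Unique.Propositional using (Unique)
open import Data.Maybe using (Maybe; just; nothing)
open import Data.Product using (Σ; ∃; _×_; _,_; proj₁; proj₂)
open import Data.Sum using (_⊎_)
open import Relation.Nullary using (¬_)
open import Relation.Nullary.Decidable using (⌊_⌋)
open import Relation.Binary.PropositionalEquality using (_≡_)

-- A finite multigraph with vertex set V = Fin (suc n), where the root q is
-- the vertex `zero` and v_i is `suc i`, and m edges indexed by Fin m (this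
-- indexing fixes the order of parallel edges).
record Multigraph (n m : ℕ) : Set where
  field
    ends : Fin m → Fin (suc n) × Fin (suc n)

module _ {n m : ℕ} (G : Multigraph n m) where
  open Multigraph G

  Vtx : Set
  Vtx = Fin (suc n)

  root : Vtx
  root = zero

  Joins : Fin m → Vtx → Vtx → Set
  Joins e u w = (ends e ≡ (u , w)) ⊎ (ends e ≡ (w , u))

  data Walk (X : Subset m) : Vtx → Vtx → List (Fin m) → Set where
    [] : ∀ {v} → Walk X v v []
    step : ∀ {e u w z es} → e ∈ X → Joins e u w → Walk X w z es → Walk X u z (e ∷ es)

  Connected : Set
  Connected = ∀ v → ∃ λ es → Walk ⊤ root v es

  -- The subgraph (U , X) is a rooted tree in the edge set S:
  -- q ∈ U, the edges of X lie in S with both endpoints in U, (U , X) is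
  -- connected, and (U , X) is acyclic (no nonempty closed walk with
  -- pairwise distinct edges, i.e. no cycle; loops and pairs of parallel
  -- edges count as cycles).
  RootedTree : Subset m → Subset (suc n) → Subset m → Set
  RootedTree S U X =
    (root ∈ U)
    × (∀ e → e ∈ X → (e ∈ S) × (proj₁ (ends e) ∈ U) × (proj₂ (ends e) ∈ U))
    × (∀ v → v ∈ U → ∃ λ es → Walk X root v es)
    × (∀ v es → Walk X v v es → Unique es → es ≡ [])

  Candidate : Subset m → Subset (suc n) → Subset m → Fin m → Set
  Candidate S U X e = (e ∈ S) × (e ∉ X) × ((proj₁ (ends e) ∈ U) ⊎ (proj₂ (ends e) ∈ U))

  -- tree growing sequence: σ S U X is σ_S(T) for T = (U , X) (nothing = undefined).
  -- The specification is only imposed on rooted trees T in S.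
  record TGS : Set where
    field
      σ : Subset m → Subset (suc n) → Subset m → Maybe (Fin m)
      σ-defined : ∀ S U X → RootedTree S U X → ∀ e → σ S U X ≡ just e → Candidate S U X e
      σ-undefined : ∀ S U X → RootedTree S U X → σ S U X ≡ nothing → ∀ e → ¬ Candidate S U X e

  IsBridge : Subset m → Fin m → Set
  IsBridge S e = (e ∈ S) × ¬ (∃ λ es → Walk (S ─ ⁅ e ⁆) (proj₁ (ends e)) (proj₂ (ends e)) es)

  inA : Subset n → Vtx → Bool
  inA A zero = false
  inA A (suc i) = lookup A i

  _==_ : Vtx → Vtx → Bool
  u == w = ⌊ u ≟ᶠ w ⌋

  outdeg : Subset n → Vtx → ℕ
  outdeg A v = sum (map (λ e → if counts (ends e) then 1 else 0) (allFin m))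
    where
    counts : Vtx × Vtx → Bool
    counts (a , b) = ((a == v) ∧ not (inA A b)) ∨ ((b == v) ∧ not (inA A a))

  IsParking : (Fin n → ℤ) → Set
  IsParking f =
    (∀ i → ℤ+ 0 ≤ f i)
    × (∀ (A : Subset n) → Nonempty A →
         ∃ λ i → (i ∈ A) × (ℤ+ 0 ≤ f i) × (f i < ℤ+ (outdeg A (suc i))))

  record State : Set where
    constructor state
    field
      S : Subset m
      U : Subset (suc n)
      X : Subset m
      α : ℕ
      β : ℕ
      fw : Fin n → ℤ

  -- output: the tree T_f = (U , X) and the exponents (α , β) of x^α y^β
  record Output : Set where
    constructor output
    field
      outU : Subset (suc n)
      outX : Subset m
      outα : ℕ
      outβ : ℕ

  decAt : (Fin n → ℤ) → Fin n → (Fin n → ℤ)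
  decAt f i j = if ⌊ j ≟ᶠ i ⌋ then f j - ℤ+ 1 else f j

  initial : (Fin n → ℤ) → State
  initial f = state ⊤ ⁅ root ⁆ ⊥ 0 0 f

  Leaving : Subset (suc n) → Fin m → Vtx → Vtx → Set
  Leaving U e t h = Joins e t h × (t ∈ U) × (h ∉ U)

  data Run (tgs : TGS) : State → Output → Set where
    done : ∀ {S U X α β f} → TGS.σ tgs S U X ≡ nothing →
           Run tgs (state S U X α β f) (output U X α β)
    cycle : ∀ {S U X α β f e out} → TGS.σ tgs S U X ≡ just e →
           proj₁ (ends e) ∈ U → proj₂ (ends e) ∈ U →
           Run tgs (state (S ─ ⁅ e ⁆) U X α (suc β) f) out →
           Run tgs (state S U X α β f) out
    negative : ∀ {S U X α β f e t i} → TGS.σ tgs S U X ≡ just e →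
           Leaving U e t (suc i) → f i < ℤ+ 0 →
           Run tgs (state S U X α β f) (output U X α β)
    addBridge : ∀ {S U X α β f e t i out} → TGS.σ tgs S U X ≡ just e →
           Leaving U e t (suc i) → f i ≡ ℤ+ 0 → IsBridge S e →
           Run tgs (state S (U ∪ ⁅ suc i ⁆) (X ∪ ⁅ e ⁆) (suc α) β f) out →
           Run tgs (state S U X α β f) out
    addNonBridge : ∀ {S U X α β f e t i out} → TGS.σ tgs S U X ≡ just e →
           Leaving U e t (suc i) → f i ≡ ℤ+ 0 → ¬ IsBridge S e →
           Run tgs (state S (U ∪ ⁅ suc i ⁆) (X ∪ ⁅ e ⁆) α β f) out →
           Run tgs (state S U X α β f) out
    decrease : ∀ {S U X α β f e t i out} → TGS.σ tgs S U X ≡ just e →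
           Leaving U e t (suc i) → ℤ+ 1 ≤ f i →
           Run tgs (state (S ─ ⁅ e ⁆) U X α β (decAt f i)) out →
           Run tgs (state S U X α β f) out

  Spanning : Output → Set
  Spanning out = ∀ v → v ∈ Output.outU out

-- Run the algorithm while recording the set D i of edges along which the counter
-- of v_i was decreased. Throughout, f(v_i) = fw(v_i) + |D i|, and an edge that has
-- left S either lies inside the tree's vertex set or is charged to some D i.
-- If the run spans, take a nonempty A and the first vertex v_i of A to enter the
-- tree: then fw(v_i) = 0, and D i together with the entering edge are distinct
-- edges from v_i to the complement of A, so 0 ≤ f(v_i) < outdeg_A(v_i).
-- If f is a parking function the counters never become negative; if the run
-- stopped with the set A of vertices missing from the tree, every edge from A to
-- the tree has been charged, so outdeg_A(v_i) ≤ |D i| ≤ f(v_i) on A, contradicting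
-- the parking condition. Each step removes an edge from S or adds a vertex to the
-- tree, so the run terminates.
module Submission where

open import Defs
open import Data.Bool using (Bool; true; false; T; if_then_else_; _∧_; _∨_; not)
open import Data.Bool.Properties using (T-≡; T-∨; T-∧; T-not-≡)
open import Data.Empty using (⊥-elim)
open import Data.Fin using (Fin; zero; suc)
open import Data.Fin.Properties using (any?) renaming (_≟_ to _≟ᶠ_)
open import Data.Fin.Subset
  using (Subset; _∈_; _∉_; ⁅_⁆; _∪_; _─_; ⊤; ⊥; ∁; Nonempty; ∣_∣; _⊆_; inside; outside)
open import Data.Fin.Subset.Properties
  using ( _∈?_; x∈⁅x⁆; x∈⁅y⁆⇒x≡y; x∈p∪q⁺; x∈p∪q⁻; p⊆p∪q; q⊆p∪q; p─q⊆p; x∈p∧x≢y⇒x∈p-y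
        ; ∉⊥; ∈⊤; ∣p∣≤n; ∣p∣≡n⇒p≡⊤; p⊆q⇒∣p∣≤∣q∣; x∈p⇒∣p-x∣<∣p∣; drop-there
        ; x∈∁p⇒x∉p; x∉p⇒x∈∁p; x∉∁p⇒x∈p; ∪-identityʳ; ∣⊥∣≡0)
open import Data.Integer using (ℤ; -[1+_]; _+_; _-_; _≤_; _<_; +≤+; +<+; -<+) renaming (+_ to ℤ+)
import Data.Integer.Properties as ℤP
open import Data.Integer.Tactic.RingSolver using (solve-∀)
open import Data.List using (List; []; _∷_; _++_; map; allFin)
import Data.List as List
open import Data.List.Properties using (map-tabulate)
open import Data.List.Membership.Propositional using () renaming (_∈_ to _∈ₗ_; _∉_ to _∉ₗ_)
open import Data.List.Membership.Propositional.Properties using (∈-++⁺ʳ)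
open import Data.List.Relation.Unary.Any using (here; there)
import Data.List.Relation.Unary.All as All
open import Data.List.Relation.Unary.AllPairs using ([]; _∷_)
open import Data.List.Relation.Unary.Unique.Propositional using (Unique)
open import Data.Maybe using (just; nothing)
open import Data.Nat as ℕ using (ℕ; zero; suc; z≤n; s≤s; _∸_)
open import Data.Nat.Induction using (<-wellFounded)
open import Data.Nat.ListAction using (sum)
import Data.Nat.Properties as ℕP
open import Data.Product using (∃; _×_; _,_; proj₁; proj₂)
open import Data.Product.Properties using (≡-dec)
open import Data.Sum using (_⊎_; inj₁; inj₂)
import Data.Sum as Sum
open import Data.Vec as Vec using (_∷_; lookup; tabulate; here; there)
open import Data.Vec.Properties using (lookup∘tabulate; []=⇒lookup; lookup⇒[]=)
open import Function using (_∘_)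
open import Function.Bundles using (_⇔_; mk⇔; Equivalence)
open import Induction.WellFounded using (Acc; acc)
open import Relation.Binary.PropositionalEquality
  using (_≡_; _≢_; refl; sym; trans; cong; subst; module ≡-Reasoning)
open import Relation.Nullary using (¬_; Dec; yes; no; ¬?; _×-dec_; _⊎-dec_)
open import Relation.Nullary.Decidable using (⌊_⌋; fromWitness; toWitness)

Unique-middle : ∀ {A : Set} {xs ys : List A} {y} → Unique (xs ++ y ∷ ys) → y ∉ₗ xs × y ∉ₗ ys
Unique-middle {xs = []} (y≢ys ∷ _) = (λ ()) , λ y∈ys → All.lookup y≢ys y∈ys refl
Unique-middle {xs = x ∷ xs} {y = y} (x≢ ∷ u) with Unique-middle {xs = xs} u
... | y∉xs , y∉ys = y∉x∷xs , y∉ys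
  where
  y∉x∷xs : y ∉ₗ x ∷ xs
  y∉x∷xs (here refl) = All.lookup x≢ (∈-++⁺ʳ xs (here refl)) refl
  y∉x∷xs (there y∈xs) = y∉xs y∈xs

∣p∪⁅x⁆∣≡1+∣p∣ : ∀ {k} {p : Subset k} {x} → x ∉ p → ∣ p ∪ ⁅ x ⁆ ∣ ≡ suc ∣ p ∣
∣p∪⁅x⁆∣≡1+∣p∣ {p = outside ∷ p} {zero} _ = cong suc (cong ∣_∣ (∪-identityʳ p))
∣p∪⁅x⁆∣≡1+∣p∣ {p = inside ∷ p} {zero} x∉p = ⊥-elim (x∉p here)
∣p∪⁅x⁆∣≡1+∣p∣ {p = outside ∷ p} {suc x} x∉p = ∣p∪⁅x⁆∣≡1+∣p∣ (x∉p ∘ there)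
∣p∪⁅x⁆∣≡1+∣p∣ {p = inside ∷ p} {suc x} x∉p = cong suc (∣p∪⁅x⁆∣≡1+∣p∣ (x∉p ∘ there))

∈tabulate⇔T : ∀ {k} {b : Fin k → Bool} {x} → x ∈ tabulate b ⇔ T (b x)
∈tabulate⇔T {b = b} {x} = mk⇔
  (λ x∈ → Equivalence.from T-≡ (trans (sym (lookup∘tabulate b x)) ([]=⇒lookup x∈)))
  (λ bx → lookup⇒[]= x (tabulate b) (trans (lookup∘tabulate b x) (Equivalence.to T-≡ bx)))

sum-indicator≡∣tabulate∣ : ∀ {k} (b : Fin k → Bool) →
  sum (map (λ x → if b x then 1 else 0) (allFin k)) ≡ ∣ tabulate b ∣
sum-indicator≡∣tabulate∣ b =
  trans (cong sum (map-tabulate (λ x → x) (λ x → if b x then 1 else 0))) (go b)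
  where
  go : ∀ {k} (b : Fin k → Bool) → sum (List.tabulate (λ x → if b x then 1 else 0)) ≡ ∣ tabulate b ∣
  go {zero} b = refl
  go {suc k} b with b zero
  ... | true = cong suc (go (b ∘ suc))
  ... | false = go (b ∘ suc)

pred+suc : ∀ (a : ℤ) k → (a - ℤ+ 1) + ℤ+ (suc k) ≡ a + ℤ+ k
pred+suc a k = trans (cong (λ z → (a - ℤ+ 1) + z) (ℤP.pos-+ 1 k)) (cancel a (ℤ+ k))
  where
  cancel : ∀ a b → (a - ℤ+ 1) + (ℤ+ 1 + b) ≡ a + b
  cancel = solve-∀

x∈p─q⇒x∉q : ∀ {k} (p q : Subset k) {x} → x ∈ p ─ q → x ∉ q
x∈p─q⇒x∉q (_ ∷ p) (inside ∷ q) () here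
x∈p─q⇒x∉q (_ ∷ p) (outside ∷ q) here ()
x∈p─q⇒x∉q (_ ∷ p) (_ ∷ q) (there x∈) (there x∈q) = x∈p─q⇒x∉q p q x∈ x∈q

module _ {n m : ℕ} (G : Multigraph n m) where
  open Multigraph G
  open import Data.List.Membership.DecPropositional (_≟ᶠ_ {m}) using () renaming (_∈?_ to _∈ₗ?_)

  private variable
    a b c h t u v w x y : Vtx G
    e : Fin m
    es fs : List (Fin m)
    S X Y : Subset m
    U : Subset (suc n)

  -- Walks and rooted trees

  joins-unique : Joins G e x y → Joins G e t h → (x ≡ t × y ≡ h) ⊎ (x ≡ h × y ≡ t)
  joins-unique (inj₁ p) (inj₁ q) = inj₁ (cong proj₁ (trans (sym p) q) , cong proj₂ (trans (sym p) q))
  joins-unique (inj₁ p) (inj₂ q) = inj₂ (cong proj₁ (trans (sym p) q) , cong proj₂ (trans (sym p) q))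
  joins-unique (inj₂ p) (inj₁ q) = inj₂ (cong proj₂ (trans (sym p) q) , cong proj₁ (trans (sym p) q))
  joins-unique (inj₂ p) (inj₂ q) = inj₁ (cong proj₂ (trans (sym p) q) , cong proj₁ (trans (sym p) q))

  joins? : ∀ e u w → Dec (Joins G e u w)
  joins? e u w = ≡-dec _≟ᶠ_ _≟ᶠ_ (ends e) (u , w) ⊎-dec ≡-dec _≟ᶠ_ _≟ᶠ_ (ends e) (w , u)

  EdgesWithin : Subset m → Subset (suc n) → Set
  EdgesWithin X U = ∀ {e} → e ∈ X → proj₁ (ends e) ∈ U × proj₂ (ends e) ∈ U

  joins-within : proj₁ (ends e) ∈ U × proj₂ (ends e) ∈ U → Joins G e u w → u ∈ U × w ∈ U
  joins-within (p , q) (inj₁ refl) = p , q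
  joins-within (p , q) (inj₂ refl) = q , p

  ends∈ : Joins G e u w → u ∈ U → w ∈ U → proj₁ (ends e) ∈ U × proj₂ (ends e) ∈ U
  ends∈ (inj₁ refl) u∈U w∈U = u∈U , w∈U
  ends∈ (inj₂ refl) u∈U w∈U = w∈U , u∈U

  endpoint∈ : Joins G e u w → u ∈ U → proj₁ (ends e) ∈ U ⊎ proj₂ (ends e) ∈ U
  endpoint∈ (inj₁ refl) u∈U = inj₁ u∈U
  endpoint∈ (inj₂ refl) u∈U = inj₂ u∈U

  walk-mono : X ⊆ Y → Walk G X a b es → Walk G Y a b es
  walk-mono X⊆Y [] = []
  walk-mono X⊆Y (step e∈X j w) = step (X⊆Y e∈X) j (walk-mono X⊆Y w)

  walk-++ : Walk G X a b es → Walk G X b c fs → Walk G X a c (es ++ fs)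
  walk-++ [] w = w
  walk-++ (step e∈X j w₁) w₂ = step e∈X j (walk-++ w₁ w₂)

  walk-restrict : Walk G (X ∪ ⁅ e ⁆) a b es → e ∉ₗ es → Walk G X a b es
  walk-restrict [] _ = []
  walk-restrict {X = X} {e = e} (step e'∈ j w) e∉ with x∈p∪q⁻ X ⁅ e ⁆ e'∈
  ... | inj₁ e'∈X = step e'∈X j (walk-restrict w (e∉ ∘ there))
  ... | inj₂ e'∈⁅e⁆ = ⊥-elim (e∉ (here (sym (x∈⁅y⁆⇒x≡y e e'∈⁅e⁆))))

  walk-split : Walk G X a b es → e ∈ₗ es →
    ∃ λ es₁ → ∃ λ es₂ → ∃ λ x → ∃ λ y →
      es ≡ es₁ ++ e ∷ es₂ × Walk G X a x es₁ × Joins G e x y × Walk G X y b es₂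
  walk-split (step _ j w) (here refl) = [] , _ , _ , _ , refl , [] , j , w
  walk-split (step e'∈X j w) (there e∈) with walk-split w e∈
  ... | es₁ , es₂ , x , y , refl , w₁ , jxy , w₂ =
    _ ∷ es₁ , es₂ , x , y , refl , step e'∈X j w₁ , jxy , w₂

  walk-ends∈ : EdgesWithin X U → Walk G X a b es → a ≡ b ⊎ (a ∈ U × b ∈ U)
  walk-ends∈ within [] = inj₁ refl
  walk-ends∈ within (step e∈X j w) with joins-within (within e∈X) j | walk-ends∈ within w
  ... | a∈U , w∈U | inj₁ refl = inj₂ (a∈U , w∈U)
  ... | a∈U , _ | inj₂ (_ , b∈U) = inj₂ (a∈U , b∈U)

  Acyclic : Subset m → Set
  Acyclic X = ∀ v es → Walk G X v v es → Unique es → es ≡ []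

  -- Splitting a closed walk at the new edge leaves a walk in X between its two
  -- endpoints, which cannot reach the new leaf h.
  acyclic-addLeaf : EdgesWithin X U → Acyclic X → Leaving G U e t h → Acyclic (X ∪ ⁅ e ⁆)
  acyclic-addLeaf {U = U} {e = e} within acyclic (j , t∈U , h∉U) v es w u with e ∈ₗ? es
  ... | no e∉es = acyclic v es (walk-restrict w e∉es) u
  ... | yes e∈es with walk-split w e∈es
  ... | es₁ , es₂ , x , y , refl , w₁ , jxy , w₂ with Unique-middle {xs = es₁} u
  ... | e∉es₁ , e∉es₂
    with walk-ends∈ within (walk-++ (walk-restrict w₂ e∉es₂) (walk-restrict w₁ e∉es₁))
       | joins-unique jxy j
  ... | inj₁ y≡x | inj₁ (refl , refl) = ⊥-elim (h∉U (subst (_∈ U) (sym y≡x) t∈U))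
  ... | inj₂ (y∈U , _) | inj₁ (refl , refl) = ⊥-elim (h∉U y∈U)
  ... | inj₁ y≡x | inj₂ (refl , refl) = ⊥-elim (h∉U (subst (_∈ U) y≡x t∈U))
  ... | inj₂ (_ , x∈U) | inj₂ (refl , refl) = ⊥-elim (h∉U x∈U)

  rootedTree-remove : RootedTree G S U X → e ∉ X → RootedTree G (S ─ ⁅ e ⁆) U X
  rootedTree-remove {X = X} (root∈U , edges , paths , acyclic) e∉X =
    root∈U , (λ e' e'∈X → x∈p∧x≢y⇒x∈p-y (proj₁ (edges e' e'∈X)) (λ { refl → e∉X e'∈X })
                          , proj₂ (edges e' e'∈X))
           , paths , acyclic

  rootedTree-addLeaf : RootedTree G S U X → e ∈ S → Leaving G U e t h →
                       RootedTree G S (U ∪ ⁅ h ⁆) (X ∪ ⁅ e ⁆)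
  rootedTree-addLeaf {S = S} {U = U} {X = X} {e = e} {t = t} {h = h}
                     (root∈U , edges , paths , acyclic) e∈S L@(j , t∈U , _) =
    p⊆p∪q ⁅ h ⁆ root∈U , edges′ , paths′ , acyclic-addLeaf (proj₂ ∘ edges _) acyclic L
    where
    h∈U′ : h ∈ U ∪ ⁅ h ⁆
    h∈U′ = q⊆p∪q U ⁅ h ⁆ (x∈⁅x⁆ h)
    e∈X′ : e ∈ X ∪ ⁅ e ⁆
    e∈X′ = q⊆p∪q X ⁅ e ⁆ (x∈⁅x⁆ e)
    edges′ : ∀ e' → e' ∈ X ∪ ⁅ e ⁆ → e' ∈ S × proj₁ (ends e') ∈ U ∪ ⁅ h ⁆ × proj₂ (ends e') ∈ U ∪ ⁅ h ⁆
    edges′ e' e'∈ with x∈p∪q⁻ X ⁅ e ⁆ e'∈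
    ... | inj₁ e'∈X = let e'∈S , p , q = edges e' e'∈X in e'∈S , p⊆p∪q ⁅ h ⁆ p , p⊆p∪q ⁅ h ⁆ q
    ... | inj₂ e'∈⁅e⁆ with x∈⁅y⁆⇒x≡y e e'∈⁅e⁆
    ... | refl = e∈S , ends∈ j (p⊆p∪q ⁅ h ⁆ t∈U) h∈U′
    paths′ : ∀ v → v ∈ U ∪ ⁅ h ⁆ → ∃ λ es → Walk G (X ∪ ⁅ e ⁆) (root G) v es
    paths′ v v∈ with x∈p∪q⁻ U ⁅ h ⁆ v∈
    ... | inj₁ v∈U = let es , w = paths v v∈U in es , walk-mono (p⊆p∪q ⁅ e ⁆) w
    ... | inj₂ v∈⁅h⁆ with x∈⁅y⁆⇒x≡y h v∈⁅h⁆
    ... | refl = let es , w = paths t t∈U in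
                 _ , walk-++ (walk-mono (p⊆p∪q ⁅ e ⁆) w) (step e∈X′ j [])

  -- Reachability and bridges

  Reachable : Subset m → Vtx G → Vtx G → Set
  Reachable Y a b = ∃ λ es → Walk G Y a b es

  Closed : Subset m → Subset (suc n) → Set
  Closed Y C = ∀ {e v w} → e ∈ Y → Joins G e v w → v ∈ C → w ∈ C

  closed-walk : ∀ {C} → Closed Y C → a ∈ C → Walk G Y a b es → b ∈ C
  closed-walk closed a∈C [] = a∈C
  closed-walk closed a∈C (step e∈Y j w) = closed-walk closed (closed e∈Y j a∈C) w

  Exit : Subset m → Subset (suc n) → Set
  Exit Y C = ∃ λ e → ∃ λ v → ∃ λ w → e ∈ Y × Joins G e v w × v ∈ C × w ∉ C

  exit? : ∀ Y C → Dec (Exit Y C)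
  exit? Y C = any? λ e → any? λ v → any? λ w →
    (e ∈? Y) ×-dec joins? e v w ×-dec (v ∈? C) ×-dec ¬? (w ∈? C)

  ¬exit⇒closed : ∀ {C} → ¬ Exit Y C → Closed Y C
  ¬exit⇒closed {C = C} ¬exit {e} {v} {w} e∈Y j v∈C with w ∈? C
  ... | yes w∈C = w∈C
  ... | no w∉C = ⊥-elim (¬exit (e , v , w , e∈Y , j , v∈C , w∉C))

  full⇒∈ : ∀ {C : Subset (suc n)} → suc n ℕ.≤ ∣ C ∣ → w ∈ C
  full⇒∈ {C = C} full = subst (_ ∈_) (sym (∣p∣≡n⇒p≡⊤ (ℕP.≤-antisym (∣p∣≤n C) full))) ∈⊤

  -- The fuel k bounds the number of vertices still missing from C.
  reachable-closure : ∀ k (C : Subset (suc n)) → suc n ℕ.≤ k ℕ.+ ∣ C ∣ → a ∈ C →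
    (∀ v → v ∈ C → Reachable Y a v) →
    ∃ λ C' → a ∈ C' × (∀ v → v ∈ C' → Reachable Y a v) × Closed Y C'
  reachable-closure {Y = Y} k C bound a∈C reach with exit? Y C
  ... | no ¬exit = C , a∈C , reach , ¬exit⇒closed ¬exit
  ... | yes (e , v , w , e∈Y , j , v∈C , w∉C) with k
  ...   | zero = ⊥-elim (w∉C (full⇒∈ bound))
  ...   | suc k = reachable-closure k (C ∪ ⁅ w ⁆) bound′ (p⊆p∪q ⁅ w ⁆ a∈C) reach′
    where
    bound′ : suc n ℕ.≤ k ℕ.+ ∣ C ∪ ⁅ w ⁆ ∣
    bound′ = ℕP.≤-trans bound (ℕP.≤-reflexive (trans (sym (ℕP.+-suc k ∣ C ∣))
                                 (cong (k ℕ.+_) (sym (∣p∪⁅x⁆∣≡1+∣p∣ w∉C)))))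
    reach′ : ∀ u → u ∈ C ∪ ⁅ w ⁆ → Reachable Y _ u
    reach′ u u∈ with x∈p∪q⁻ C ⁅ w ⁆ u∈
    ... | inj₁ u∈C = reach u u∈C
    ... | inj₂ u∈⁅w⁆ with x∈⁅y⁆⇒x≡y w u∈⁅w⁆
    ... | refl = let es , walk = reach v v∈C in _ , walk-++ walk (step e∈Y j [])

  reachable? : ∀ Y a b → Dec (Reachable Y a b)
  reachable? Y a b with reachable-closure (suc n) ⁅ a ⁆ (ℕP.m≤m+n (suc n) _) (x∈⁅x⁆ a) reach₀
    where
    reach₀ : ∀ v → v ∈ ⁅ a ⁆ → Reachable Y a v
    reach₀ v v∈⁅a⁆ with x∈⁅y⁆⇒x≡y a v∈⁅a⁆
    ... | refl = [] , []
  ... | C , a∈C , reach , closed with b ∈? C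
  ... | yes b∈C = yes (reach b b∈C)
  ... | no b∉C = no λ (_ , walk) → b∉C (closed-walk closed a∈C walk)

  isBridge? : ∀ S e → Dec (IsBridge G S e)
  isBridge? S e = (e ∈? S) ×-dec ¬? (reachable? (S ─ ⁅ e ⁆) (proj₁ (ends e)) (proj₂ (ends e)))

  -- Out-degrees as cardinalities

  -- Must stay definitionally equal to the indicator in the definition of outdeg.
  leaves : Subset n → Vtx G → Vtx G × Vtx G → Bool
  leaves A v (a , b) = (⌊ a ≟ᶠ v ⌋ ∧ not (inA G A b)) ∨ (⌊ b ≟ᶠ v ⌋ ∧ not (inA G A a))

  OutEdges : Subset n → Vtx G → Subset m
  OutEdges A v = tabulate (λ e → leaves A v (ends e))

  outdeg≡∣OutEdges∣ : ∀ A v → outdeg G A v ≡ ∣ OutEdges A v ∣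
  outdeg≡∣OutEdges∣ A v = sum-indicator≡∣tabulate∣ (λ e → leaves A v (ends e))

  leaves⇔ : ∀ A v a b → T (leaves A v (a , b)) ⇔
            ((a ≡ v × inA G A b ≡ false) ⊎ (b ≡ v × inA G A a ≡ false))
  leaves⇔ A v a b = mk⇔
    (Sum.map (side a b ∘ Equivalence.to T-∧) (side b a ∘ Equivalence.to T-∧) ∘ Equivalence.to T-∨)
    (Equivalence.from T-∨ ∘
      Sum.map (Equivalence.from T-∧ ∘ side⁻¹ a b) (Equivalence.from T-∧ ∘ side⁻¹ b a))
    where
    side : ∀ a b → T ⌊ a ≟ᶠ v ⌋ × T (not (inA G A b)) → a ≡ v × inA G A b ≡ false
    side a b (a≡v , b∉A) = toWitness a≡v , Equivalence.to T-not-≡ b∉A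
    side⁻¹ : ∀ a b → a ≡ v × inA G A b ≡ false → T ⌊ a ≟ᶠ v ⌋ × T (not (inA G A b))
    side⁻¹ a b (a≡v , b∉A) = fromWitness a≡v , Equivalence.from T-not-≡ b∉A

  joins⇒∈OutEdges : ∀ {A} → Joins G e w v → inA G A w ≡ false → e ∈ OutEdges A v
  joins⇒∈OutEdges {w = w} {v} {A} (inj₁ ends≡) w∉A = Equivalence.from ∈tabulate⇔T
    (subst (T ∘ leaves A v) (sym ends≡) (Equivalence.from (leaves⇔ A v w v) (inj₂ (refl , w∉A))))
  joins⇒∈OutEdges {w = w} {v} {A} (inj₂ ends≡) w∉A = Equivalence.from ∈tabulate⇔T
    (subst (T ∘ leaves A v) (sym ends≡) (Equivalence.from (leaves⇔ A v v w) (inj₁ (refl , w∉A))))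

  ∈OutEdges⇒joins : ∀ {A} → e ∈ OutEdges A v → ∃ λ w → Joins G e w v × inA G A w ≡ false
  ∈OutEdges⇒joins {e} {v} {A} e∈
    with Equivalence.to (leaves⇔ A v (proj₁ (ends e)) (proj₂ (ends e))) (Equivalence.to ∈tabulate⇔T e∈)
  ... | inj₁ (refl , b∉A) = proj₂ (ends e) , inj₂ refl , b∉A
  ... | inj₂ (refl , a∉A) = proj₁ (ends e) , inj₁ refl , a∉A

  Avoids : Subset n → Subset (suc n) → Set
  Avoids A U = ∀ i → i ∈ A → suc i ∉ U

  avoids⇒inA≡false : ∀ {A U} → Avoids A U → w ∈ U → inA G A w ≡ false
  avoids⇒inA≡false {zero} avoids w∈U = refl
  avoids⇒inA≡false {suc i} {A} avoids w∈U with lookup A i in eq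
  ... | false = refl
  ... | true = ⊥-elim (avoids i (lookup⇒[]= i A eq) w∈U)

  Missing : Subset (suc n) → Subset n
  Missing U = ∁ (Vec.tail U)

  ∈Missing⇔∉ : ∀ {i} → i ∈ Missing U ⇔ suc i ∉ U
  ∈Missing⇔∉ {_ ∷ U} = mk⇔ (λ i∈ si∈ → x∈∁p⇒x∉p i∈ (drop-there si∈)) (λ si∉ → x∉p⇒x∈∁p (si∉ ∘ there))

  inA-Missing≡false⇒∈ : root G ∈ U → inA G (Missing U) w ≡ false → w ∈ U
  inA-Missing≡false⇒∈ {w = zero} root∈U _ = root∈U
  inA-Missing≡false⇒∈ {U = _ ∷ U} {suc i} _ eq =
    there (x∉∁p⇒x∈p λ i∈ → true≢false (trans (sym ([]=⇒lookup i∈)) eq))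
    where
    true≢false : true ≢ false
    true≢false ()

  missing-nonempty : root G ∈ U → v ∉ U → Nonempty (Missing U)
  missing-nonempty {v = zero} root∈U root∉U = ⊥-elim (root∉U root∈U)
  missing-nonempty {v = suc k} _ sk∉U = k , Equivalence.from ∈Missing⇔∉ sk∉U

  decAt-nonneg : ∀ {fw : Fin n → ℤ} {i} → (∀ k → ℤ+ 0 ≤ fw k) → ℤ+ 1 ≤ fw i →
                 ∀ k → ℤ+ 0 ≤ decAt G fw i k
  decAt-nonneg {i = i} fw≥0 fw≥1 k with k ≟ᶠ i
  ... | yes refl = ℤP.i≤j⇒0≤j-i fw≥1
  ... | no _ = fw≥0 k

  charge : (Fin n → Subset m) → Fin n → Fin m → Fin n → Subset m
  charge D i e j = if ⌊ j ≟ᶠ i ⌋ then D j ∪ ⁅ e ⁆ else D j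

  e∈charge : ∀ D i → e ∈ charge D i e i
  e∈charge {e} D i with i ≟ᶠ i
  ... | yes _ = q⊆p∪q (D i) ⁅ e ⁆ (x∈⁅x⁆ e)
  ... | no i≢i = ⊥-elim (i≢i refl)

  D⊆charge : ∀ D i j → D j ⊆ charge D i e j
  D⊆charge {e} D i j with j ≟ᶠ i
  ... | yes _ = p⊆p∪q ⁅ e ⁆
  ... | no _ = λ x∈ → x∈

  avoids-⁅root⁆ : ∀ {A} → Avoids A ⁅ root G ⁆
  avoids-⁅root⁆ i _ si∈ with x∈⁅y⁆⇒x≡y (root G) si∈
  ... | ()

  avoids-∪⁅⁆ : ∀ {A U i} → Avoids A U → i ∉ A → Avoids A (U ∪ ⁅ suc i ⁆)
  avoids-∪⁅⁆ {A} {U} {i} avoids i∉A k k∈A sk∈ with x∈p∪q⁻ U ⁅ suc i ⁆ sk∈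
  ... | inj₁ sk∈U = avoids k k∈A sk∈U
  ... | inj₂ sk∈⁅si⁆ with x∈⁅y⁆⇒x≡y (suc i) sk∈⁅si⁆
  ... | refl = i∉A k∈A

  rootedTree-initial : RootedTree G ⊤ ⁅ root G ⁆ ⊥
  rootedTree-initial = x∈⁅x⁆ (root G) , (λ _ e∈⊥ → ⊥-elim (∉⊥ e∈⊥)) , paths , acyclic
    where
    paths : ∀ v → v ∈ ⁅ root G ⁆ → ∃ λ es → Walk G ⊥ (root G) v es
    paths v v∈ with x∈⁅y⁆⇒x≡y (root G) v∈
    ... | refl = [] , []
    acyclic : Acyclic ⊥
    acyclic v .[] [] _ = refl
    acyclic v _ (step e∈⊥ _ _) _ = ⊥-elim (∉⊥ e∈⊥)

  -- The algorithm

  module _ (tgs : TGS G) where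
    open TGS tgs

    measure : State G → ℕ
    measure st = ∣ State.S st ∣ ℕ.+ (suc n ∸ ∣ State.U st ∣)

    removing-decreases : ∀ k → e ∈ S → ∣ S ─ ⁅ e ⁆ ∣ ℕ.+ k ℕ.< ∣ S ∣ ℕ.+ k
    removing-decreases k e∈S = ℕP.+-monoˡ-< k (x∈p⇒∣p-x∣<∣p∣ e∈S)

    adding-decreases : ∀ k → h ∉ U →
                       k ℕ.+ (suc n ∸ ∣ U ∪ ⁅ h ⁆ ∣) ℕ.< k ℕ.+ (suc n ∸ ∣ U ∣)
    adding-decreases {U = U} k h∉U = ℕP.+-monoʳ-< k
      (ℕP.∸-monoʳ-< (ℕP.≤-reflexive (sym (∣p∪⁅x⁆∣≡1+∣p∣ h∉U))) (∣p∣≤n (U ∪ ⁅ _ ⁆)))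

    RunsBelow : ℕ → Set
    RunsBelow k = ∀ S U X α β fw → measure (state S U X α β fw) ℕ.< k → RootedTree G S U X →
                  ∃ (Run G tgs (state S U X α β fw))

    run-leaving : ∀ S U X α β fw → RunsBelow (measure (state S U X α β fw)) → RootedTree G S U X →
                  σ S U X ≡ just e → e ∈ S → e ∉ X → Leaving G U e t h →
                  ∃ (Run G tgs (state S U X α β fw))
    run-leaving {h = zero} S U X α β fw _ T _ _ _ (_ , _ , root∉U) = ⊥-elim (root∉U (proj₁ T))
    run-leaving {e} {h = suc i} S U X α β fw runs T σ≡ e∈S e∉X L@(_ , _ , h∉U) with fw i in fw≡
    ... | -[1+ _ ] = _ , negative σ≡ L (subst (_< ℤ+ 0) (sym fw≡) -<+)
    ... | ℤ+ (suc _) =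
      let out , r = runs (S ─ ⁅ e ⁆) U X α β (decAt G fw i)
                         (removing-decreases _ e∈S) (rootedTree-remove T e∉X)
      in out , decrease σ≡ L (subst (ℤ+ 1 ≤_) (sym fw≡) (+≤+ (s≤s z≤n))) r
    ... | ℤ+ zero with isBridge? S e
    ... | yes bridge =
      let out , r = runs S (U ∪ ⁅ suc i ⁆) (X ∪ ⁅ e ⁆) (suc α) β fw
                         (adding-decreases _ h∉U) (rootedTree-addLeaf T e∈S L)
      in out , addBridge σ≡ L fw≡ bridge r
    ... | no ¬bridge =
      let out , r = runs S (U ∪ ⁅ suc i ⁆) (X ∪ ⁅ e ⁆) α β fw
                         (adding-decreases _ h∉U) (rootedTree-addLeaf T e∈S L)
      in out , addNonBridge σ≡ L fw≡ ¬bridge r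

    run-step : ∀ S U X α β fw → RunsBelow (measure (state S U X α β fw)) → RootedTree G S U X →
               ∃ (Run G tgs (state S U X α β fw))
    run-step S U X α β fw runs T with σ S U X in σ≡
    ... | nothing = _ , done σ≡
    ... | just e with σ-defined S U X T e σ≡
    ... | e∈S , e∉X , touches with proj₁ (ends e) ∈? U | proj₂ (ends e) ∈? U
    ... | yes a∈U | yes b∈U =
      let out , r = runs (S ─ ⁅ e ⁆) U X α (suc β) fw
                         (removing-decreases _ e∈S) (rootedTree-remove T e∉X)
      in out , cycle σ≡ a∈U b∈U r
    ... | yes a∈U | no b∉U = run-leaving S U X α β fw runs T σ≡ e∈S e∉X (inj₁ refl , a∈U , b∉U)
    ... | no a∉U | yes b∈U = run-leaving S U X α β fw runs T σ≡ e∈S e∉X (inj₂ refl , b∈U , a∉U)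
    ... | no a∉U | no b∉U = ⊥-elim (Sum.[ a∉U , b∉U ] touches)

    run : ∀ S U X α β fw → Acc ℕ._<_ (measure (state S U X α β fw)) → RootedTree G S U X →
          ∃ (Run G tgs (state S U X α β fw))
    run S U X α β fw (acc rec) =
      run-step S U X α β fw (λ S′ U′ X′ α′ β′ fw′ lt → run S′ U′ X′ α′ β′ fw′ (rec lt))

    module _ (f₀ : Fin n → ℤ) where

      ParkingWitness : Subset n → Set
      ParkingWitness A = ∃ λ i → i ∈ A × ℤ+ 0 ≤ f₀ i × f₀ i < ℤ+ (outdeg G A (suc i))

      record Invariant (S : Subset m) (U : Subset (suc n)) (X : Subset m) (fw : Fin n → ℤ)
                       (D : Fin n → Subset m) : Set where
        field
          tree : RootedTree G S U X
          charged∉S : ∀ i {e} → e ∈ D i → e ∉ S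
          charged-joins : ∀ i {e} → e ∈ D i → ∃ λ t → t ∈ U × Joins G e t (suc i)
          balance : ∀ i → f₀ i ≡ fw i + ℤ+ ∣ D i ∣
          removed : ∀ e → e ∉ S → (proj₁ (ends e) ∈ U × proj₂ (ends e) ∈ U) ⊎ ∃ λ i → e ∈ D i

      open Invariant

      invariant-initial : Invariant ⊤ ⁅ root G ⁆ ⊥ f₀ (λ _ → ⊥)
      invariant-initial = record
        { tree = rootedTree-initial
        ; charged∉S = λ _ e∈⊥ → ⊥-elim (∉⊥ e∈⊥)
        ; charged-joins = λ _ e∈⊥ → ⊥-elim (∉⊥ e∈⊥)
        ; balance = λ i → sym (trans (cong (λ k → f₀ i + ℤ+ k) (∣⊥∣≡0 m)) (ℤP.+-identityʳ (f₀ i)))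
        ; removed = λ e e∉⊤ → ⊥-elim (e∉⊤ ∈⊤)
        }

      private variable
        α β : ℕ
        out : Output G
        fw : Fin n → ℤ
        D : Fin n → Subset m
        A : Subset n
        i : Fin n

      invariant-cycle : Invariant S U X fw D → σ S U X ≡ just e →
                        proj₁ (ends e) ∈ U → proj₂ (ends e) ∈ U → Invariant (S ─ ⁅ e ⁆) U X fw D
      invariant-cycle {S} {U} {X} {D = D} {e = e} I σ≡ a∈U b∈U = record
        { tree = rootedTree-remove (tree I) (proj₁ (proj₂ (σ-defined S U X (tree I) e σ≡)))
        ; charged∉S = λ i e'∈D e'∈S′ → charged∉S I i e'∈D (p─q⊆p S ⁅ e ⁆ e'∈S′)
        ; charged-joins = charged-joins I
        ; balance = balance I
        ; removed = removed′
        }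
        where
        removed′ : ∀ e' → e' ∉ S ─ ⁅ e ⁆ →
                   (proj₁ (ends e') ∈ U × proj₂ (ends e') ∈ U) ⊎ ∃ λ i → e' ∈ D i
        removed′ e' e'∉ with e' ≟ᶠ e
        ... | yes refl = inj₁ (a∈U , b∈U)
        ... | no e'≢e = removed I e' (λ e'∈S → e'∉ (x∈p∧x≢y⇒x∈p-y e'∈S e'≢e))

      invariant-addLeaf : Invariant S U X fw D → σ S U X ≡ just e → Leaving G U e t h →
                          Invariant S (U ∪ ⁅ h ⁆) (X ∪ ⁅ e ⁆) fw D
      invariant-addLeaf {S} {U} {X} {e = e} {h = h} I σ≡ L = record
        { tree = rootedTree-addLeaf (tree I) (proj₁ (σ-defined S U X (tree I) e σ≡)) L
        ; charged∉S = charged∉S I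
        ; charged-joins = λ i e'∈D → let t , t∈U , j = charged-joins I i e'∈D in t , U⊆U′ t∈U , j
        ; balance = balance I
        ; removed = λ e' e'∉S →
            Sum.map (λ (a∈U , b∈U) → U⊆U′ a∈U , U⊆U′ b∈U) (λ c → c) (removed I e' e'∉S)
        }
        where
        U⊆U′ : U ⊆ U ∪ ⁅ h ⁆
        U⊆U′ = p⊆p∪q ⁅ h ⁆

      invariant-decrease : Invariant S U X fw D → σ S U X ≡ just e → Leaving G U e t (suc i) →
                           Invariant (S ─ ⁅ e ⁆) U X (decAt G fw i) (charge D i e)
      invariant-decrease {S} {U} {X} {fw} {D} {e} {t} {i} I σ≡ (j , t∈U , _) = record
        { tree = rootedTree-remove (tree I) e∉X
        ; charged∉S = charged∉S′
        ; charged-joins = charged-joins′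
        ; balance = balance′
        ; removed = removed′
        }
        where
        e∈S : e ∈ S
        e∈S = proj₁ (σ-defined S U X (tree I) e σ≡)
        e∉X : e ∉ X
        e∉X = proj₁ (proj₂ (σ-defined S U X (tree I) e σ≡))
        charged∉S′ : ∀ k {e'} → e' ∈ charge D i e k → e' ∉ S ─ ⁅ e ⁆
        charged∉S′ k e'∈ e'∈S′ with k ≟ᶠ i
        ... | no _ = charged∉S I k e'∈ (p─q⊆p S ⁅ e ⁆ e'∈S′)
        ... | yes refl with x∈p∪q⁻ (D k) ⁅ e ⁆ e'∈
        ...   | inj₁ e'∈D = charged∉S I k e'∈D (p─q⊆p S ⁅ e ⁆ e'∈S′)
        ...   | inj₂ e'∈⁅e⁆ = x∈p─q⇒x∉q S ⁅ e ⁆ e'∈S′ e'∈⁅e⁆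
        charged-joins′ : ∀ k {e'} → e' ∈ charge D i e k → ∃ λ t → t ∈ U × Joins G e' t (suc k)
        charged-joins′ k e'∈ with k ≟ᶠ i
        ... | no _ = charged-joins I k e'∈
        ... | yes refl with x∈p∪q⁻ (D k) ⁅ e ⁆ e'∈
        ...   | inj₁ e'∈D = charged-joins I k e'∈D
        ...   | inj₂ e'∈⁅e⁆ with x∈⁅y⁆⇒x≡y e e'∈⁅e⁆
        ...     | refl = t , t∈U , j
        balance′ : ∀ k → f₀ k ≡ decAt G fw i k + ℤ+ ∣ charge D i e k ∣
        balance′ k with k ≟ᶠ i
        ... | no _ = balance I k
        ... | yes refl = begin
          f₀ k                               ≡⟨ balance I k ⟩
          fw k + ℤ+ ∣ D k ∣                  ≡⟨ pred+suc (fw k) ∣ D k ∣ ⟨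
          (fw k - ℤ+ 1) + ℤ+ (suc ∣ D k ∣)   ≡⟨ cong (λ c → (fw k - ℤ+ 1) + ℤ+ c) ∣D∪⁅e⁆∣ ⟨
          (fw k - ℤ+ 1) + ℤ+ ∣ D k ∪ ⁅ e ⁆ ∣ ∎
          where
          open ≡-Reasoning
          ∣D∪⁅e⁆∣ : ∣ D k ∪ ⁅ e ⁆ ∣ ≡ suc ∣ D k ∣
          ∣D∪⁅e⁆∣ = ∣p∪⁅x⁆∣≡1+∣p∣ (λ e∈D → charged∉S I k e∈D e∈S)
        removed′ : ∀ e' → e' ∉ S ─ ⁅ e ⁆ →
                   (proj₁ (ends e') ∈ U × proj₂ (ends e') ∈ U) ⊎ ∃ λ k → e' ∈ charge D i e k
        removed′ e' e'∉ with e' ≟ᶠ e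
        ... | yes refl = inj₂ (i , e∈charge D i)
        ... | no e'≢e with removed I e' (λ e'∈S → e'∉ (x∈p∧x≢y⇒x∈p-y e'∈S e'≢e))
        ...   | inj₁ ends∈U = inj₁ ends∈U
        ...   | inj₂ (k , e'∈D) = inj₂ (k , D⊆charge D i k e'∈D)

      parks-on-entry : Invariant S U X fw D → σ S U X ≡ just e → Leaving G U e t (suc i) →
                       fw i ≡ ℤ+ 0 → Avoids A U → ℤ+ 0 ≤ f₀ i × f₀ i < ℤ+ (outdeg G A (suc i))
      parks-on-entry {S} {U} {X} {fw} {D} {e} {t} {i} {A} I σ≡ (j , t∈U , _) fw≡0 avoids =
        subst (ℤ+ 0 ≤_) (sym f₀≡) (+≤+ z≤n) , subst (_< _) (sym f₀≡) (+<+ charged<outdeg)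
        where
        f₀≡ : f₀ i ≡ ℤ+ ∣ D i ∣
        f₀≡ = trans (balance I i) (cong (_+ ℤ+ ∣ D i ∣) fw≡0)
        e∉D : e ∉ D i
        e∉D e∈D = charged∉S I i e∈D (proj₁ (σ-defined S U X (tree I) e σ≡))
        charged⊆OutEdges : D i ∪ ⁅ e ⁆ ⊆ OutEdges A (suc i)
        charged⊆OutEdges e'∈ with x∈p∪q⁻ (D i) ⁅ e ⁆ e'∈
        ... | inj₁ e'∈D = let _ , t'∈U , j' = charged-joins I i e'∈D in
                          joins⇒∈OutEdges j' (avoids⇒inA≡false avoids t'∈U)
        ... | inj₂ e'∈⁅e⁆ rewrite x∈⁅y⁆⇒x≡y e e'∈⁅e⁆ = joins⇒∈OutEdges j (avoids⇒inA≡false avoids t∈U)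
        charged<outdeg : ∣ D i ∣ ℕ.< outdeg G A (suc i)
        charged<outdeg = begin
          suc ∣ D i ∣            ≡⟨ ∣p∪⁅x⁆∣≡1+∣p∣ e∉D ⟨
          ∣ D i ∪ ⁅ e ⁆ ∣        ≤⟨ p⊆q⇒∣p∣≤∣q∣ charged⊆OutEdges ⟩
          ∣ OutEdges A (suc i) ∣ ≡⟨ outdeg≡∣OutEdges∣ A (suc i) ⟨
          outdeg G A (suc i)     ∎
          where open ℕP.≤-Reasoning

      on-entry : Invariant S U X fw D → σ S U X ≡ just e → Leaving G U e t (suc i) → fw i ≡ ℤ+ 0 →
                 (Avoids A (U ∪ ⁅ suc i ⁆) → ParkingWitness A) → Avoids A U → ParkingWitness A
      on-entry {i = i} {A} I σ≡ L fw≡0 continue avoids with i ∈? A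
      ... | yes i∈A = i , i∈A , parks-on-entry I σ≡ L fw≡0 avoids
      ... | no i∉A = continue (avoids-∪⁅⁆ avoids i∉A)

      first-entry-parks : Run G tgs (state S U X α β fw) out → Invariant S U X fw D →
                          Nonempty A → Spanning G out → Avoids A U → ParkingWitness A
      first-entry-parks (done _) _ (k , k∈A) spans avoids = ⊥-elim (avoids k k∈A (spans (suc k)))
      first-entry-parks (negative _ _ _) _ (k , k∈A) spans avoids = ⊥-elim (avoids k k∈A (spans (suc k)))
      first-entry-parks (cycle σ≡ a∈U b∈U r) I = first-entry-parks r (invariant-cycle I σ≡ a∈U b∈U)
      first-entry-parks (decrease σ≡ L _ r) I = first-entry-parks r (invariant-decrease I σ≡ L)
      first-entry-parks (addBridge σ≡ L fw≡0 _ r) I nonempty spans =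
        on-entry I σ≡ L fw≡0 (first-entry-parks r (invariant-addLeaf I σ≡ L) nonempty spans)
      first-entry-parks (addNonBridge σ≡ L fw≡0 _ r) I nonempty spans =
        on-entry I σ≡ L fw≡0 (first-entry-parks r (invariant-addLeaf I σ≡ L) nonempty spans)

      stuck-charged : σ S U X ≡ nothing → Invariant S U X fw D →
                      Joins G e w (suc i) → w ∈ U → suc i ∉ U → e ∈ D i
      stuck-charged {S} {U} {X} {e = e} σ≡ I j w∈U si∉U with e ∈? S
      ... | yes e∈S = ⊥-elim (σ-undefined S U X (tree I) σ≡ e (e∈S , e∉X , endpoint∈ j w∈U))
        where
        e∉X : e ∉ X
        e∉X e∈X = si∉U (proj₂ (joins-within (proj₂ (proj₁ (proj₂ (tree I)) e e∈X)) j))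
      ... | no e∉S with removed I e e∉S
      ...   | inj₁ ends∈U = ⊥-elim (si∉U (proj₂ (joins-within ends∈U j)))
      ...   | inj₂ (k , e∈D) with charged-joins I k e∈D
      ...     | t , t∈U , jt with joins-unique jt j
      ...       | inj₁ (_ , refl) = e∈D
      ...       | inj₂ (refl , _) = ⊥-elim (si∉U t∈U)

      stuck-OutEdges⊆charged : σ S U X ≡ nothing → Invariant S U X fw D → suc i ∉ U →
                               OutEdges (Missing U) (suc i) ⊆ D i
      stuck-OutEdges⊆charged σ≡ I si∉U e∈ =
        let _ , j , w∉M = ∈OutEdges⇒joins e∈ in
        stuck-charged σ≡ I j (inA-Missing≡false⇒∈ (proj₁ (tree I)) w∉M) si∉U

      stuck-spans : σ S U X ≡ nothing → Invariant S U X fw D → (∀ i → ℤ+ 0 ≤ fw i) →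
                    IsParking G f₀ → ∀ v → v ∈ U
      stuck-spans {U = U} {fw = fw} {D} σ≡ I fw≥0 (_ , parking) v with v ∈? U
      ... | yes v∈U = v∈U
      ... | no v∉U with parking (Missing U) (missing-nonempty (proj₁ (tree I)) v∉U)
      ...   | j , j∈M , _ , f₀<outdeg = ⊥-elim (ℤP.<⇒≱ f₀<outdeg outdeg≤f₀)
        where
        open ℤP.≤-Reasoning
        outdeg≤f₀ : ℤ+ (outdeg G (Missing U) (suc j)) ≤ f₀ j
        outdeg≤f₀ = begin
          ℤ+ (outdeg G (Missing U) (suc j))    ≡⟨ cong ℤ+ (outdeg≡∣OutEdges∣ (Missing U) (suc j)) ⟩
          ℤ+ ∣ OutEdges (Missing U) (suc j) ∣  ≤⟨ +≤+ (p⊆q⇒∣p∣≤∣q∣ out⊆D) ⟩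
          ℤ+ ∣ D j ∣                           ≤⟨ ℤP.+-monoˡ-≤ (ℤ+ ∣ D j ∣) (fw≥0 j) ⟩
          fw j + ℤ+ ∣ D j ∣                    ≡⟨ balance I j ⟨
          f₀ j                                 ∎
          where
          out⊆D : OutEdges (Missing U) (suc j) ⊆ D j
          out⊆D = stuck-OutEdges⊆charged σ≡ I (Equivalence.to ∈Missing⇔∉ j∈M)

      parking-run-spans : Run G tgs (state S U X α β fw) out → Invariant S U X fw D →
                          (∀ i → ℤ+ 0 ≤ fw i) → IsParking G f₀ → Spanning G out
      parking-run-spans (done σ≡) I fw≥0 parking = stuck-spans σ≡ I fw≥0 parking
      parking-run-spans (negative {i = i} _ _ fw<0) _ fw≥0 _ = ⊥-elim (ℤP.≤⇒≯ (fw≥0 i) fw<0)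
      parking-run-spans (cycle σ≡ a∈U b∈U r) I = parking-run-spans r (invariant-cycle I σ≡ a∈U b∈U)
      parking-run-spans (addBridge σ≡ L _ _ r) I = parking-run-spans r (invariant-addLeaf I σ≡ L)
      parking-run-spans (addNonBridge σ≡ L _ _ r) I = parking-run-spans r (invariant-addLeaf I σ≡ L)
      parking-run-spans (decrease σ≡ L fw≥1 r) I fw≥0 =
        parking-run-spans r (invariant-decrease I σ≡ L) (decAt-nonneg fw≥0 fw≥1)

      run-initial : ∃ (Run G tgs (initial G f₀))
      run-initial = run ⊤ ⁅ root G ⁆ ⊥ 0 0 f₀ (<-wellFounded _) rootedTree-initial

      spanning⇒parking : Run G tgs (initial G f₀) out → Spanning G out → IsParking G f₀
      spanning⇒parking r spans = nonneg , λ _ → parks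
        where
        parks : Nonempty A → ParkingWitness A
        parks nonempty = first-entry-parks r invariant-initial nonempty spans avoids-⁅root⁆
        nonneg : ∀ i → ℤ+ 0 ≤ f₀ i
        nonneg i with parks (i , x∈⁅x⁆ i)
        ... | j , j∈⁅i⁆ , 0≤f₀j , _ rewrite x∈⁅y⁆⇒x≡y i j∈⁅i⁆ = 0≤f₀j

      parking⇒spanning : Run G tgs (initial G f₀) out → IsParking G f₀ → Spanning G out
      parking⇒spanning r parking = parking-run-spans r invariant-initial (proj₁ parking) parking

proposition2p1p1 : ∀ {n m : ℕ} (G : Multigraph n m) → Connected G →
    (tgs : TGS G) (f : Fin n → ℤ) →
    (∃ λ out → Run G tgs (initial G f) out)
    × (∀ out → Run G tgs (initial G f) out → (Spanning G out ⇔ IsParking G f))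
proposition2p1p1 G _ tgs f =
  run-initial G tgs f , λ _ r → mk⇔ (spanning⇒parking G tgs f r) (parking⇒spanning G tgs f r)
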